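{- Let $(N,+,-)$ be a DFBQ, let $o$ be its right additive identity ($a+o=a$ for all $a$) and $e$ the element with $a-a=e$ for all $a$. Let $\bar e\in N$ be such that $e+\bar e=o$, and define $\phi:x\mapsto x+\bar e$ and $\alpha:x\mapsto x-e$. Define $a\oplus b=\phi^{ -1}(\phi a+\phi b)$ and $a\ominus b=\alpha^{ -1}(a-b)$. Then $(N,\oplus,\ominus)$ is a DFBQ in which $e$ is a right identity for $\oplus$ and $a\ominus a=e$ for all $a$, and moreover $a\ominus e=a$ for all $a\in N$.
   Context: A DFBQ $(N,+,-)$ is a set $N$ with two binary operations $+$ and $-$ such that $(N,+)$ and $(N,-)$ are both quasigroups (for all $a,b$, the equations $a\circ x=b$ and $y\circ a=b$ have unique solutions) and $a-b=(a+c)-(b+c)$ for all $a,b,c\in N$. Every DFBQ has a unique right identity $o$ for $+$ and an element $e$ with $a-a=e$ for all $a$; the maps $\phi,\alpha$ above are permutations of $N$. -}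

module Defs where

open import Level using (Level)
open import Data.Product using (Σ; _×_; _,_; proj₁)
open import Relation.Binary.PropositionalEquality using (_≡_)

UniqueSol : ∀ {ℓ} {A : Set ℓ} → (A → Set ℓ) → Set ℓ
UniqueSol {A = A} P = Σ A λ x → P x × (∀ y → P y → y ≡ x)

record IsQuasigroup {ℓ} (A : Set ℓ) (_∘_ : A → A → A) : Set ℓ where
  field
    leftSol  : ∀ a b → UniqueSol (λ x → a ∘ x ≡ b)
    rightSol : ∀ a b → UniqueSol (λ y → y ∘ a ≡ b)

record IsDFBQ {ℓ} (N : Set ℓ) (_+_ _-_ : N → N → N) : Set ℓ where
  field
    plus-quasigroup : IsQuasigroup N _+_
    minus-quasigroup : IsQuasigroup N _-_
    shift        : ∀ a b c → a - b ≡ (a + c) - (b + c)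

module DFBQOps {ℓ} {N : Set ℓ} {_+_ _-_ : N → N → N}
               (D : IsDFBQ N _+_ _-_) (e ē : N) where
  open IsDFBQ D
  open IsQuasigroup

  φ : N → N
  φ x = x + ē

  φ⁻¹ : N → N
  φ⁻¹ y = proj₁ (rightSol plus-quasigroup ē y)

  α : N → N
  α x = x - e

  α⁻¹ : N → N
  α⁻¹ y = proj₁ (rightSol minus-quasigroup e y)

  _⊕_ : N → N → N
  a ⊕ b = φ⁻¹ (φ a + φ b)

  _⊖_ : N → N → N
  a ⊖ b = α⁻¹ (a - b)

-- Both new operations are isotopes of the old ones: ⊕ is + conjugated by the right
-- translation φ, and ⊖ is - followed by the inverse of the right translation α. Isotopes
-- of quasigroups are quasigroups, and the shift law survives because - is invariant under
-- right translation, so a - b = φ a - φ b = (φ a + φ c) - (φ b + φ c) = φ (a ⊕ c) - φ (b ⊕ c)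
-- = (a ⊕ c) - (b ⊕ c). The three identities come from φ e = e + ē = o and α e = e - e = e.
module Submission where

open import Defs
open import Data.Product using (_×_; _,_; proj₁; proj₂)
open import Function.Bundles using (_↔_; mk↔ₛ′; Inverse)
open import Function.Properties.Inverse using (↔-refl; ↔-sym)
open import Relation.Binary.PropositionalEquality
  using (_≡_; refl; sym; trans; cong; cong₂; module ≡-Reasoning)

open Inverse
open IsQuasigroup

rightTranslation↔ : ∀ {ℓ} {A : Set ℓ} {_∘_ : A → A → A} →
                    IsQuasigroup A _∘_ → A → A ↔ A
rightTranslation↔ {_∘_ = _∘_} Q a =
  mk↔ₛ′ (_∘ a) (λ b → proj₁ (rightSol Q a b))
    (λ b → proj₁ (proj₂ (rightSol Q a b)))
    (λ x → sym (proj₂ (proj₂ (rightSol Q a (x ∘ a))) x refl))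

isotope-isQuasigroup : ∀ {ℓ} {A B : Set ℓ} {_∘_ : B → B → B} →
                       IsQuasigroup B _∘_ → (f h : A ↔ B) (g : B ↔ A) →
                       IsQuasigroup A (λ x y → to g (to f x ∘ to h y))
isotope-isQuasigroup {_∘_ = _∘_} Q f h g = record
  { leftSol  = λ a b →
      let (s , s-sol , s-unique) = leftSol Q (to f a) (from g b) in
      from h s
      , trans (cong (λ u → to g (to f a ∘ u)) (strictlyInverseˡ h s))
              (trans (cong (to g) s-sol) (strictlyInverseˡ g b))
      , λ y y-sol → trans (sym (strictlyInverseʳ h y))
                          (cong (from h) (s-unique (to h y) (untwist y-sol)))
  ; rightSol = λ a b →
      let (s , s-sol , s-unique) = rightSol Q (to h a) (from g b) in
      from f s
      , trans (cong (λ u → to g (u ∘ to h a)) (strictlyInverseˡ f s))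
              (trans (cong (to g) s-sol) (strictlyInverseˡ g b))
      , λ y y-sol → trans (sym (strictlyInverseʳ f y))
                          (cong (from f) (s-unique (to f y) (untwist y-sol)))
  }
  where
  untwist : ∀ {u b} → to g u ≡ b → u ≡ from g b
  untwist {u} refl = sym (strictlyInverseʳ g u)

module _ {ℓ} {N : Set ℓ} {_+_ _-_ : N → N → N} (D : IsDFBQ N _+_ _-_) (e ē : N) where
  open IsDFBQ D
  open DFBQOps D e ē

  φ↔ : N ↔ N
  φ↔ = rightTranslation↔ plus-quasigroup ē

  α↔ : N ↔ N
  α↔ = rightTranslation↔ minus-quasigroup e

  φ-⊕ : ∀ a b → φ (a ⊕ b) ≡ φ a + φ b
  φ-⊕ a b = strictlyInverseˡ φ↔ (φ a + φ b)

  ⊕-⊖-shift : ∀ a b c → a ⊖ b ≡ (a ⊕ c) ⊖ (b ⊕ c)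
  ⊕-⊖-shift a b c = cong α⁻¹ (begin
    a - b                           ≡⟨ shift a b ē ⟩
    φ a - φ b                       ≡⟨ shift (φ a) (φ b) (φ c) ⟩
    (φ a + φ c) - (φ b + φ c)       ≡⟨ sym (cong₂ _-_ (φ-⊕ a c) (φ-⊕ b c)) ⟩
    φ (a ⊕ c) - φ (b ⊕ c)           ≡⟨ sym (shift (a ⊕ c) (b ⊕ c) ē) ⟩
    (a ⊕ c) - (b ⊕ c)               ∎)
    where open ≡-Reasoning

  ⊕-⊖-isDFBQ : IsDFBQ N _⊕_ _⊖_
  ⊕-⊖-isDFBQ = record
    { plus-quasigroup  = isotope-isQuasigroup plus-quasigroup φ↔ φ↔ (↔-sym φ↔)
    ; minus-quasigroup = isotope-isQuasigroup minus-quasigroup ↔-refl ↔-refl (↔-sym α↔)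
    ; shift            = ⊕-⊖-shift
    }

  ⊕-identityʳ : ∀ o → (∀ a → a + o ≡ a) → e + ē ≡ o → ∀ a → a ⊕ e ≡ a
  ⊕-identityʳ o +-identityʳ e+ē≡o a = begin
    φ⁻¹ (φ a + φ e)  ≡⟨ cong (λ u → φ⁻¹ (φ a + u)) e+ē≡o ⟩
    φ⁻¹ (φ a + o)    ≡⟨ cong φ⁻¹ (+-identityʳ (φ a)) ⟩
    φ⁻¹ (φ a)        ≡⟨ strictlyInverseʳ φ↔ a ⟩
    a                ∎
    where open ≡-Reasoning

  ⊖-identityʳ : ∀ a → a ⊖ e ≡ a
  ⊖-identityʳ = strictlyInverseʳ α↔

  ⊖-self : (∀ a → a - a ≡ e) → ∀ a → a ⊖ a ≡ e
  ⊖-self diagonal a = trans (cong α⁻¹ (trans (diagonal a) (sym (diagonal e)))) (⊖-identityʳ e)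

mainTheorem6 : ∀ {ℓ} (N : Set ℓ) (_+_ _-_ : N → N → N) (D : IsDFBQ N _+_ _-_)
    (o e ē : N) → (∀ a → a + o ≡ a) → (∀ a → a - a ≡ e) → e + ē ≡ o →
    IsDFBQ N (DFBQOps._⊕_ D e ē) (DFBQOps._⊖_ D e ē)
    × (∀ a → DFBQOps._⊕_ D e ē a e ≡ a)
    × (∀ a → DFBQOps._⊖_ D e ē a a ≡ e)
    × (∀ a → DFBQOps._⊖_ D e ē a e ≡ a)
mainTheorem6 N _+_ _-_ D o e ē +-identityʳ diagonal≡e e+ē≡o =
  ⊕-⊖-isDFBQ D e ē
  , ⊕-identityʳ D e ē o +-identityʳ e+ē≡o
  , ⊖-self D e ē diagonal≡e
  , ⊖-identityʳ D e ē
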